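{- For every propositional formula $\pi$ that is neither a tautology nor a contradiction, the formula $\langle\ddagger\pi\rangle\top\wedge[\ddagger\pi](\neg\Box\pi\wedge\neg\Box\neg\pi)$ is true at every world of every serial Kripke model (i.e. every model in which every world has at least one $R$-successor).
   Context: Atoms come from a countable non-empty set $\mathit{At}$. Formulas are built from $\top$, atoms, $\neg$, $\wedge$, $\Box$ and $[\ddagger\pi]\varphi$ for propositional $\pi$; $\langle\ddagger\pi\rangle\varphi:=\neg[\ddagger\pi]\neg\varphi$. A Kripke model $\mathcal M=\langle W,R,V\rangle$ has $W\neq\varnothing$, $R\subseteq W\times W$, $V:\mathit{At}\to\mathcal P(W)$; $\mathcal M,w\models\Box\varphi$ iff $\mathcal M,v\models\varphi$ for all $v$ with $wRv$. A literal is an atom or its negation; a clause is a finite set $D$ of literals read as $\bigvee D$ ($\bigvee\varnothing=\bot$); it is tautological if it contains $p$ and $\neg p$ for some $p$. For propositional $\pi$, $\mathcal C(\pi)$ is the set of non-tautological clauses $D$ with $\models\pi\to\bigvee D$ such that no $D'\subsetneq D$ has $\models\pi\to\bigvee D'$. For a finite set of non-tautological clauses $\{D_i:i\in I\}$ with $0\notin I$, $\mathcal M^{\{D_i:i\in I\}}_u=\langle W',R',V'\rangle$ has $W'=W\times(\{0\}\cup I)$, $(w,i)R'(v,j)$ iff $wRv$, $(w,0)\in V'(p)$ iff $w\in V(p)$, and for $i\in I$: $(w,i)\in V'(p)$ iff $\neg p\in D_i$, or ($\{p,\neg p\}\cap D_i=\varnothing$ and $w\in V(p)$). $\mathcal M,w\models[\ddagger\pi]\varphi$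 iff for all $D_1\in\mathcal C(\pi)$ and $D_2\in\mathcal C(\neg\pi)$, $\mathcal M^{\{D_1,D_2\}}_u,(w,0)\models\varphi$ ($D_1$ indexed by $1$, $D_2$ by $2$). -}

module Defs where

open import Data.Nat using (ℕ)
import Data.Nat as ℕ
open import Data.Bool using (Bool; true; false; not; _∧_; _∨_; if_then_else_)
open import Data.Fin using (Fin; zero; suc)
open import Data.Vec using (Vec; []; _∷_; lookup)
open import Data.List using (List; []; _∷_)
open import Data.Product using (Σ; ∃; _×_; _,_)
open import Data.Empty using (⊥)
open import Data.Unit using () renaming (⊤ to ⊤ᵗ)
open import Relation.Nullary using (¬_; yes; no; Dec)
open import Relation.Nullary.Decidable using (⌊_⌋)
open import Relation.Binary.Definitions using (DecidableEquality)
open import Relation.Binary.PropositionalEquality using (_≡_; refl; cong)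
open import Function.Definitions using (Injective)

≟-from-code : {A : Set} (code : A → ℕ) → Injective _≡_ _≡_ code → DecidableEquality A
≟-from-code code inj x y with code x ℕ.≟ code y
... | yes e = yes (inj e)
... | no ne = no (λ e → ne (cong code e))

module Logic (At : Set) (_≟_ : DecidableEquality At) where

  data PForm : Set where
    p⊤   : PForm
    patom : At → PForm
    p¬   : PForm → PForm
    _p∧_ : PForm → PForm → PForm

  data Form : Set where
    ⊤'    : Form
    atom  : At → Form
    ¬'_   : Form → Form
    _∧'_  : Form → Form → Form
    □_    : Form → Form
    [‡_]_ : PForm → Form → Form

  ⟨‡_⟩_ : PForm → Form → Form
  ⟨‡ π ⟩ φ = ¬' ([‡ π ] (¬' φ))

  ⌜_⌝ : PForm → Form
  ⌜ p⊤ ⌝ = ⊤'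
  ⌜ patom p ⌝ = atom p
  ⌜ p¬ π ⌝ = ¬' ⌜ π ⌝
  ⌜ π p∧ ρ ⌝ = ⌜ π ⌝ ∧' ⌜ ρ ⌝

  eval : (At → Bool) → PForm → Bool
  eval v p⊤ = true
  eval v (patom p) = v p
  eval v (p¬ π) = not (eval v π)
  eval v (π p∧ ρ) = eval v π ∧ eval v ρ

  Tautology : PForm → Set
  Tautology π = ∀ (v : At → Bool) → eval v π ≡ true

  Contradiction : PForm → Set
  Contradiction π = ∀ (v : At → Bool) → eval v π ≡ false

  -- literals and clauses (a clause is a finite set of literals, given as a list)
  data Literal : Set where
    pos : At → Literal
    neg : At → Literal

  Clause : Set
  Clause = List Literal

  _∈_ : Literal → Clause → Set
  l ∈ [] = ⊥
  l ∈ (k ∷ D) = (l ≡ k) Data.Sum.⊎ (l ∈ D)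
    where import Data.Sum

  _⊆_ : Clause → Clause → Set
  D ⊆ E = ∀ {l} → l ∈ D → l ∈ E

  _⊊_ : Clause → Clause → Set
  D ⊊ E = D ⊆ E × ¬ (E ⊆ D)

  Tautological : Clause → Set
  Tautological D = Σ At λ p → pos p ∈ D × neg p ∈ D

  evalLit : (At → Bool) → Literal → Bool
  evalLit v (pos p) = v p
  evalLit v (neg p) = not (v p)

  evalClause : (At → Bool) → Clause → Bool
  evalClause v [] = false
  evalClause v (l ∷ D) = evalLit v l ∨ evalClause v D

  Entails : PForm → Clause → Set
  Entails π D = ∀ (v : At → Bool) → eval v π ≡ true → evalClause v D ≡ true

  InC : PForm → Clause → Set
  InC π D = ¬ Tautological D × Entails π D × (∀ D' → D' ⊊ D → ¬ Entails π D')

  _≟L_ : DecidableEquality Literal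
  pos p ≟L pos q with p ≟ q
  ... | yes refl = yes refl
  ... | no ne = no λ { refl → ne refl }
  pos p ≟L neg q = no λ ()
  neg p ≟L pos q = no λ ()
  neg p ≟L neg q with p ≟ q
  ... | yes refl = yes refl
  ... | no ne = no λ { refl → ne refl }

  _∈ᵇ_ : Literal → Clause → Bool
  l ∈ᵇ [] = false
  l ∈ᵇ (k ∷ D) = ⌊ l ≟L k ⌋ ∨ (l ∈ᵇ D)

  record Model : Set₁ where
    field
      W : Set
      R : W → W → Set
      V : At → W → Bool
  open Model public

  Serial : Model → Set
  Serial M = ∀ (w : W M) → Σ (W M) λ v → R M w v

  updVal : Clause → Bool → At → Bool
  updVal D b p =
    if neg p ∈ᵇ D then true else (if pos p ∈ᵇ D then false else b)

  -- 𝓜^{D_i : i ∈ I}_u with I = {1..n}; index zero is the original copy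
  update : ∀ {n} → Model → Vec Clause n → Model
  update {n} M Ds = record
    { W = W M × Fin (ℕ.suc n)
    ; R = λ { (w , i) (v , j) → R M w v }
    ; V = λ { p (w , zero) → V M p w
            ; p (w , suc i) → updVal (lookup Ds i) (V M p w) p }
    }

  _,_⊨_ : (M : Model) → W M → Form → Set
  M , w ⊨ ⊤' = ⊤ᵗ
  M , w ⊨ atom p = V M p w ≡ true
  M , w ⊨ (¬' φ) = ¬ (M , w ⊨ φ)
  M , w ⊨ (φ ∧' ψ) = (M , w ⊨ φ) × (M , w ⊨ ψ)
  M , w ⊨ (□ φ) = ∀ v → R M w v → M , v ⊨ φ
  M , w ⊨ ([‡ π ] φ) =
    ∀ (D₁ D₂ : Clause) → InC π D₁ → InC (p¬ π) D₂ →
      update M (D₁ ∷ D₂ ∷ []) , (w , zero) ⊨ φ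

-- If π is not a tautology, some valuation v refutes it, and the clause of
-- literals false at v on the atoms of π is entailed by π; shrinking it gives
-- (classically, hence under ¬¬, which is all ⟨‡π⟩⊤ asks for) a clause of
-- 𝒞(π), and likewise of 𝒞(¬π).  In the copy of the update indexed by a
-- non-tautological clause D every literal of D is false, so any formula
-- entailing ⋁ D fails there.  By seriality w sees a successor v, hence both
-- (v, 1), where π fails, and (v, 2), where ¬π fails.
module Submission where

open import Defs
open import Data.Bool using (Bool; true; false; not; _∧_; _≟_)
open import Data.Bool.Properties using (∨-conicalˡ; ∨-conicalʳ; not-¬; ¬-not; not-injective)
open import Data.Empty using (⊥-elim)
open import Data.Fin using (zero; suc)
open import Data.List using (List; []; _∷_; _++_; map; filter; length)
open import Data.List.Properties using (filter-notAll)
open import Data.List.Membership.Propositional using () renaming (_∈_ to _∈ₛ_)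
open import Data.List.Membership.Propositional.Properties using (∈-filter⁺; ∈-filter⁻; ∈-map⁺; ∈-map⁻)
open import Data.List.Relation.Unary.All as All using (All; []; _∷_)
open import Data.List.Relation.Unary.All.Properties using (++⁻)
open import Data.List.Relation.Unary.Any using (Any; here; there)
open import Data.Nat using (ℕ; _<_)
open import Data.Nat.Induction using (<-wellFounded)
open import Data.Product using (Σ; _×_; _,_; proj₁)
open import Data.Sum using (inj₁; inj₂)
open import Data.Unit using (tt)
open import Data.Vec using (Vec; []; _∷_; lookup)
open import Function.Definitions using (Injective)
open import Induction.WellFounded using (Acc; acc)
open import Relation.Binary.Definitions using (DecidableEquality)
open import Relation.Binary.PropositionalEquality using (_≡_; _≢_; refl; cong; cong₂; trans)
open import Relation.Nullary using (¬_; Dec; yes; no; _because_)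
open import Relation.Nullary.Decidable using (isYes≗does; decidable-stable; ¬¬-excluded-middle)
open import Relation.Nullary.Reflects using (Reflects; ofʸ; ofⁿ; ¬-reflects; _×-reflects_; _⊎-reflects_; det)

module Properties (At : Set) (_≟ᴬ_ : DecidableEquality At) where
  open Logic At _≟ᴬ_

  ∈ᵇ-reflects : ∀ l D → Reflects (l ∈ D) (l ∈ᵇ D)
  ∈ᵇ-reflects l []      = ofⁿ λ ()
  ∈ᵇ-reflects l (k ∷ D) rewrite isYes≗does (l ≟L k) = Dec.proof (l ≟L k) ⊎-reflects ∈ᵇ-reflects l D

  _∈?_ : ∀ l D → Dec (l ∈ D)
  l ∈? D = (l ∈ᵇ D) because ∈ᵇ-reflects l D

  ∈⇒∈ᵇ : ∀ {l D} → l ∈ D → l ∈ᵇ D ≡ true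
  ∈⇒∈ᵇ {l} {D} l∈D = det (∈ᵇ-reflects l D) (ofʸ l∈D)

  ∉⇒∈ᵇ≡false : ∀ {l D} → ¬ l ∈ D → l ∈ᵇ D ≡ false
  ∉⇒∈ᵇ≡false {l} {D} l∉D = det (∈ᵇ-reflects l D) (ofⁿ l∉D)

  ∈⇒∈ₛ : ∀ {l D} → l ∈ D → l ∈ₛ D
  ∈⇒∈ₛ {D = _ ∷ _} (inj₁ refl) = here refl
  ∈⇒∈ₛ {D = _ ∷ _} (inj₂ l∈D)  = there (∈⇒∈ₛ l∈D)

  ∈ₛ⇒∈ : ∀ {l D} → l ∈ₛ D → l ∈ D
  ∈ₛ⇒∈ (here refl)  = inj₁ refl
  ∈ₛ⇒∈ (there l∈D) = inj₂ (∈ₛ⇒∈ l∈D)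

  ⊈⇒∃∉ : ∀ {E} D → ¬ (D ⊆ E) → Any (λ l → ¬ l ∈ E) D
  ⊈⇒∃∉ []      D⊈E = ⊥-elim (D⊈E λ ())
  ⊈⇒∃∉ {E} (k ∷ D) D⊈E with k ∈? E
  ... | no k∉E  = here k∉E
  ... | yes k∈E = there (⊈⇒∃∉ D λ D⊆E → D⊈E λ { (inj₁ refl) → k∈E ; (inj₂ l∈D) → D⊆E l∈D })

  Falsifies : (At → Bool) → Clause → Set
  Falsifies u D = ∀ {l} → l ∈ D → evalLit u l ≡ false

  falsifies⇒evalClause≡false : ∀ {u} D → Falsifies u D → evalClause u D ≡ false
  falsifies⇒evalClause≡false []      _  = refl
  falsifies⇒evalClause≡false (k ∷ D) uD
    rewrite uD (inj₁ refl) = falsifies⇒evalClause≡false D (λ l∈D → uD (inj₂ l∈D))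

  evalClause≡false⇒falsifies : ∀ {u} D → evalClause u D ≡ false → Falsifies u D
  evalClause≡false⇒falsifies {u} (k ∷ D) e (inj₁ refl) = ∨-conicalˡ (evalLit u k) _ e
  evalClause≡false⇒falsifies {u} (k ∷ D) e (inj₂ l∈D)  =
    evalClause≡false⇒falsifies D (∨-conicalʳ (evalLit u k) _ e) l∈D

  ¬falsifies⇒evalClause≡true : ∀ {u} D → ¬ Falsifies u D → evalClause u D ≡ true
  ¬falsifies⇒evalClause≡true D ¬uD = ¬-not (λ e → ¬uD (evalClause≡false⇒falsifies D e))

  falsifies⇒¬tautological : ∀ {u D} → Falsifies u D → ¬ Tautological D
  falsifies⇒¬tautological uD (p , pos∈D , neg∈D) =
    not-¬ (uD pos∈D) (not-injective {y = true} (uD neg∈D))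

  falsifies⇒¬entailed : ∀ {π D u} → Entails π D → Falsifies u D → eval u π ≢ true
  falsifies⇒¬entailed {D = D} {u} πD uD πu =
    not-¬ (falsifies⇒evalClause≡false D uD) (πD u πu)

  entails-⊆ : ∀ {π D E} → D ⊆ E → Entails π D → Entails π E
  entails-⊆ {π} {E = E} D⊆E πD u πu =
    ¬falsifies⇒evalClause≡true E λ uE → falsifies⇒¬entailed {π} πD (λ l∈D → uE (D⊆E l∈D)) πu

  ⊆-¬tautological : ∀ {D E} → D ⊆ E → ¬ Tautological E → ¬ Tautological D
  ⊆-¬tautological D⊆E ntE (p , pos∈D , neg∈D) = ntE (p , D⊆E pos∈D , D⊆E neg∈D)

  atoms : PForm → List At
  atoms p⊤        = []
  atoms (patom p) = p ∷ []
  atoms (p¬ π)    = atoms π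
  atoms (π p∧ ρ)  = atoms π ++ atoms ρ

  eval-cong : ∀ {u v} π → All (λ p → u p ≡ v p) (atoms π) → eval u π ≡ eval v π
  eval-cong p⊤        _        = refl
  eval-cong (patom p) (e ∷ []) = e
  eval-cong (p¬ π)    u≗v      = cong not (eval-cong π u≗v)
  eval-cong (π p∧ ρ)  u≗v with ++⁻ (atoms π) u≗v
  ... | u≗vᵖ , u≗vʳ = cong₂ _∧_ (eval-cong π u≗vᵖ) (eval-cong ρ u≗vʳ)

  literal : Bool → At → Literal
  literal true  p = neg p
  literal false p = pos p

  evalLit-literal≡false⇒ : ∀ u b p → evalLit u (literal b p) ≡ false → u p ≡ b
  evalLit-literal≡false⇒ u true  p e = not-injective e
  evalLit-literal≡false⇒ u false p e = e

  evalLit-literal≡false : ∀ u p → evalLit u (literal (u p) p) ≡ false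
  evalLit-literal≡false u p with u p in e
  ... | true  = cong not e
  ... | false = e

  refutingClause : (At → Bool) → PForm → Clause
  refutingClause v π = map (λ p → literal (v p) p) (atoms π)

  refutingClause-falsified : ∀ v π → Falsifies v (refutingClause v π)
  refutingClause-falsified v π l∈C with ∈-map⁻ _ (∈⇒∈ₛ l∈C)
  ... | p , _ , refl = evalLit-literal≡false v p

  -- A valuation falsifying the refuting clause of v agrees with v on the atoms of π.
  refutingClause-entailed : ∀ {v} π → eval v π ≡ false → Entails π (refutingClause v π)
  refutingClause-entailed {v} π vπ u πu = ¬falsifies⇒evalClause≡true _ λ uC →
    not-¬ (trans (eval-cong π (All.tabulate λ {p} p∈π →
             evalLit-literal≡false⇒ u (v p) p (uC (∈ₛ⇒∈ (∈-map⁺ (λ q → literal (v q) q) p∈π))))) vπ) πu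

  restrict : Clause → Clause → Clause
  restrict E D = filter (_∈? E) D

  restrict-⊆ : ∀ E D → restrict E D ⊆ D
  restrict-⊆ E D l∈ = ∈ₛ⇒∈ (proj₁ (∈-filter⁻ (_∈? E) (∈⇒∈ₛ l∈)))

  ⊆-restrict : ∀ {E D} → E ⊆ D → E ⊆ restrict E D
  ⊆-restrict {E} E⊆D l∈E = ∈ₛ⇒∈ (∈-filter⁺ (_∈? E) (∈⇒∈ₛ (E⊆D l∈E)) l∈E)

  restrict-shorter : ∀ {E} D → ¬ (D ⊆ E) → length (restrict E D) < length D
  restrict-shorter {E} D D⊈E = filter-notAll (_∈? E) D (⊈⇒∃∉ D D⊈E)

  minimal-below : ∀ {π} D → Acc _<_ (length D) → ¬ Tautological D → Entails π D →
                  ¬ ¬ Σ Clause (InC π)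
  minimal-below {π} D (acc shorter) ntD πD no𝒞 =
    ¬¬-excluded-middle {A = Σ Clause λ E → E ⊊ D × Entails π E} λ where
      (no none) → no𝒞 (D , ntD , πD , λ E E⊊D πE → none (E , E⊊D , πE))
      (yes (E , (E⊆D , D⊈E) , πE)) →
        minimal-below {π} (restrict E D) (shorter (restrict-shorter D D⊈E))
          (⊆-¬tautological (restrict-⊆ E D) ntD) (entails-⊆ {π} (⊆-restrict E⊆D) πE) no𝒞

  𝒞-nonempty : ∀ {π} → ¬ Tautology π → ¬ ¬ Σ Clause (InC π)
  𝒞-nonempty {π} ¬taut no𝒞 = ¬taut λ v → decidable-stable (eval v π ≟ true) λ πv≢true →
    minimal-below {π} (refutingClause v π) (<-wellFounded _)
      (falsifies⇒¬tautological (refutingClause-falsified v π))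
      (refutingClause-entailed π (¬-not πv≢true)) no𝒞

  ¬contradiction⇒¬tautology-p¬ : ∀ {π} → ¬ Contradiction π → ¬ Tautology (p¬ π)
  ¬contradiction⇒¬tautology-p¬ ¬contr taut = ¬contr λ v → not-injective {y = false} (taut v)

  valuation : (M : Model) → W M → At → Bool
  valuation M x p = V M p x

  ⊨⌜⌝-reflects : ∀ M x π → Reflects (M , x ⊨ ⌜ π ⌝) (eval (valuation M x) π)
  ⊨⌜⌝-reflects M x p⊤        = ofʸ tt
  ⊨⌜⌝-reflects M x (patom p) with V M p x
  ... | true  = ofʸ refl
  ... | false = ofⁿ λ ()
  ⊨⌜⌝-reflects M x (p¬ π)    = ¬-reflects (⊨⌜⌝-reflects M x π)
  ⊨⌜⌝-reflects M x (π p∧ ρ)  = ⊨⌜⌝-reflects M x π ×-reflects ⊨⌜⌝-reflects M x ρ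

  updVal-falsifies : ∀ {D} (b : At → Bool) → ¬ Tautological D →
                     Falsifies (λ p → updVal D (b p) p) D
  updVal-falsifies b ntD {pos p} pos∈D
    rewrite ∉⇒∈ᵇ≡false (λ neg∈D → ntD (p , pos∈D , neg∈D)) | ∈⇒∈ᵇ pos∈D = refl
  updVal-falsifies b ntD {neg p} neg∈D rewrite ∈⇒∈ᵇ neg∈D = refl

  copy-⊭ : ∀ {n π} M (Ds : Vec Clause n) i v → InC π (lookup Ds i) →
           ¬ (update M Ds , (v , suc i) ⊨ ⌜ π ⌝)
  copy-⊭ {π = π} M Ds i v (ntD , πD , _) vπ =
    falsifies⇒¬entailed {π} πD (updVal-falsifies (valuation M v) ntD)
      (det (⊨⌜⌝-reflects (update M Ds) (v , suc i) π) (ofʸ vπ))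

corollary12 : (At : Set) (code : At → ℕ) (inj : Injective _≡_ _≡_ code) → At →
    let open Logic At (≟-from-code code inj) in
    (π : PForm) → ¬ Tautology π → ¬ Contradiction π →
    (M : Model) → Serial M → (w : W M) →
    M , w ⊨ ((⟨‡ π ⟩ ⊤') ∧' ([‡ π ] ((¬' (□ ⌜ π ⌝)) ∧' (¬' (□ (¬' ⌜ π ⌝))))))
corollary12 At code inj _ π ¬taut ¬contr M serial w = ⟨‡π⟩⊤ , [‡π]¬□π∧¬□¬π
  where
  open Logic At (≟-from-code code inj)
  open Properties At (≟-from-code code inj)

  ⟨‡π⟩⊤ : M , w ⊨ (⟨‡ π ⟩ ⊤')
  ⟨‡π⟩⊤ none =
    𝒞-nonempty {π} ¬taut λ (D₁ , D₁∈𝒞) →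
    𝒞-nonempty {p¬ π} (¬contradiction⇒¬tautology-p¬ {π} ¬contr) λ (D₂ , D₂∈𝒞) →
    none D₁ D₂ D₁∈𝒞 D₂∈𝒞 tt

  [‡π]¬□π∧¬□¬π : M , w ⊨ ([‡ π ] ((¬' (□ ⌜ π ⌝)) ∧' (¬' (□ (¬' ⌜ π ⌝)))))
  [‡π]¬□π∧¬□¬π D₁ D₂ D₁∈𝒞 D₂∈𝒞 with serial w
  ... | v , wRv =
    (λ □π → copy-⊭ M Ds zero v D₁∈𝒞 (□π (v , suc zero) wRv)) ,
    (λ □¬π → copy-⊭ {π = p¬ π} M Ds (suc zero) v D₂∈𝒞 (□¬π (v , suc (suc zero)) wRv))
    where
    Ds : Vec Clause 2
    Ds = D₁ ∷ D₂ ∷ []
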